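{- Let $G$ be an instance of well-structured MAP, and let $H$ be a spanning subgraph of $G$ that contains all zero-edges of $G$ and is simple, bridgeless and of minimum degree at least two. Let $\mathcal{A}$ be a small 2ec-block of $H$. Then $\mathcal{A}$ has at least one swappable pair. Moreover, if $\mathcal{A}$ is a 3-cycle, then $\mathcal{A}$ has at least one swappable edge.
   Context: An instance of MAP is a loop-free, 2-edge connected multigraph $G$ with edge costs in $\{0,1\}$ whose cost-$0$ edges ("zero-edges") form a matching; cost-$1$ edges are unit-edges. A graph is 2-edge connected (2EC) if it has at least $2$ nodes and is connected after deleting any single edge. It is 2NC if it has at least $3$ nodes and is connected after deleting any single node. A 2-ECSS is a 2EC spanning subgraph, and $\mathrm{opt}(\cdot)$ is its minimum cost. $G/S$ identifies the nodes of $S$ into a node $\hat v$ and deletes the edges inside $S$. For a cut node $w$ of a 2EC graph $M$, a 2ec-$w$-block is the subgraph induced by $\{w\}\cup V(D)$ for a component $D$ of $M-w$. An attachment of a subgraph $C$ of $G$ is a node of $C$ with a neighbour in $V(G)-V(C)$, and $\delta(S)$ is the set of edges with exactly one end in $S$. An instance of well-structured MAP is an instance of MAP with at least $12$ nodes containing none of the following: a cut node; parallel edges; a zero-cost S2; a unit-cost S2; an S$\{3,4\}$; an R4; an R8. These are defined as follows. (1) A zero-cost S2 is a zero-edge $uv$ with $G-\{u,v\}$ disconnected. (2) A unit-cost S2 is a unit-edge $uv$ with $G-\{u,v\}$ disconnected such that $G/\{u,v\}$ has two distinct 2ec-$\hat v$-blocks, each with $\mathrm{opt}\ge3$ and each containing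 a zero-edge incident to $\hat v$. (3) An S$\{3,4\}$ is an induced 2NC subgraph $C$ with $|V(C)|\in\{3,4\}$ satisfying all of the following. It has a spanning cycle of cost $2$. The graph $G-V(C)$ is disconnected. The cut $\delta(V(C))$ has no zero-edge. The graph $G/V(C)$ has two distinct 2ec-$\hat v$-blocks, each with $\mathrm{opt}\ge3$. (4) An R4 is an induced subgraph $C$ on $4$ nodes, $V(C)\ne V(G)$, containing a 4-cycle of cost $2$ and two nonadjacent nodes each of degree $2$ in $G$. (5) An R8 is an induced subgraph $C$ on $8$ nodes, $V(C)\ne V(G)$, satisfying all of the following. It contains two node-disjoint 4-cycles $C_1,C_2$ of cost $2$. It has exactly two attachments $a_1\in V(C_1)$ and $a_2\in V(C_2)$. For $i=1,2$, both ends of the unique unit-edge of $C_i-a_i$ are adjacent to $V(C_{3-i})$. A 2ec-block of $H$ is a maximal connected subgraph of $H$ with at least two nodes and no bridges; here these are the connected components of $H$. A 2ec-block is small if it has at most $2$ unit-edges. For a small 2ec-block $\mathcal{A}$ of $H$: - A unit-edge $uw$ of $\mathcal{A}$ is swappable if both $u$ and $w$ are attachments of $\mathcal{A}$ in $G$. - A pair of nodes $\{u,w\}$ of $\mathcal{A}$ is a swappable pair if either (i) $uw$ is a swappable edge of $\mathcal{A}$, or (ii) $u,w$ are not adjacent in $\mathcal{A}$ and the other two nodes of $\mathcal{A}$ are adjacent in $G$. -}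

module Defs where

open import Data.Nat using (ℕ; zero; suc; _+_; _≤_)
open import Data.Fin using (Fin; zero; suc)
open import Data.Fin.Properties using (_≟_)
open import Data.Bool using (Bool; true; false; T; not; _∧_; _∨_; if_then_else_)
open import Data.Product using (Σ; ∃; ∃₂; _×_; _,_; proj₁; proj₂)
open import Data.Sum using (_⊎_)
open import Data.Unit using (⊤)
open import Relation.Nullary using (¬_)
open import Relation.Nullary.Decidable using (⌊_⌋)
open import Relation.Binary.PropositionalEquality using (_≡_; _≢_)

sumF : ∀ {k} → (Fin k → ℕ) → ℕ
sumF {zero} f = 0
sumF {suc k} f = f zero + sumF (λ i → f (suc i))

count : ∀ {k} → (Fin k → Bool) → ℕ
count P = sumF (λ i → if P i then 1 else 0)

-- Multigraphs on node set Fin n with edge identifiers Fin m.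
-- An edge e has (ordered representation of its) ends 'ends e'.

Ends : ℕ → ℕ → Set
Ends n m = Fin m → Fin n × Fin n

module _ {n m : ℕ} where

  Joins : Ends n m → Fin m → Fin n → Fin n → Set
  Joins ends e x y = ends e ≡ (x , y) ⊎ ends e ≡ (y , x)

  Inc : Ends n m → Fin m → Fin n → Set
  Inc ends e x = proj₁ (ends e) ≡ x ⊎ proj₂ (ends e) ≡ x

  incB : Ends n m → Fin m → Fin n → Bool
  incB ends e x = ⌊ proj₁ (ends e) ≟ x ⌋ ∨ ⌊ proj₂ (ends e) ≟ x ⌋

  deg : Ends n m → (Fin m → Bool) → Fin n → ℕ
  deg ends F x = count (λ e → F e ∧ incB ends e x)


-- cost of an edge set; z e = true iff e is a zero-edge (else cost 1)
costOf : ∀ {m} → (Fin m → Bool) → (Fin m → Bool) → ℕ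
costOf z F = sumF (λ e → if F e then (if z e then 0 else 1) else 0)

record Gr (n m : ℕ) : Set₁ where
  field
    vs   : Fin n → Set
    es   : Fin m → Set
    ends : Ends n m
open Gr public

module _ {n m : ℕ} where

  full : Ends n m → Gr n m
  full ends = record { vs = λ _ → ⊤ ; es = λ _ → ⊤ ; ends = ends }

  spanSub : Gr n m → (Fin m → Bool) → Gr n m
  spanSub g F = record { vs = vs g ; es = λ e → T (F e) ; ends = ends g }

  data Reach (g : Gr n m) : Fin n → Fin n → Set where
    here : ∀ {x} → Reach g x x
    step : ∀ {x y z} (e : Fin m) → es g e → Joins (ends g) e x y →
           Reach g y z → Reach g x z

  Connected : Gr n m → Set
  Connected g = ∀ x y → vs g x → vs g y → Reach g x y

  AtLeast2 : Gr n m → Set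
  AtLeast2 g = ∃₂ λ x y → x ≢ y × vs g x × vs g y

  AtLeast3 : Gr n m → Set
  AtLeast3 g = ∃₂ λ x y → ∃ λ w →
    x ≢ y × x ≢ w × y ≢ w × vs g x × vs g y × vs g w

  delE : Gr n m → Fin m → Gr n m
  delE g f = record { vs = vs g ; es = λ e → es g e × e ≢ f ; ends = ends g }

  delVs : Gr n m → (Fin n → Set) → Gr n m
  delVs g S = record
    { vs = λ x → vs g x × ¬ S x
    ; es = λ e → es g e × ¬ S (proj₁ (ends g e)) × ¬ S (proj₂ (ends g e))
    ; ends = ends g }

  delV : Gr n m → Fin n → Gr n m
  delV g x = delVs g (λ y → y ≡ x)

  induced : Gr n m → (Fin n → Set) → Gr n m
  induced g S = record
    { vs = λ x → vs g x × S x
    ; es = λ e → es g e × S (proj₁ (ends g e)) × S (proj₂ (ends g e))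
    ; ends = ends g }

  TwoEC : Gr n m → Set
  TwoEC g = AtLeast2 g × Connected g × (∀ e → es g e → Connected (delE g e))

  TwoNC : Gr n m → Set
  TwoNC g = AtLeast3 g × Connected g × (∀ x → vs g x → Connected (delV g x))

  IsCutNode : Gr n m → Fin n → Set
  IsCutNode g x = vs g x × ¬ Connected (delV g x)

  -- g / S : identify the nodes of S into the node r (r ∈ S is the name of
  -- the new node v̂) and delete the edges with both ends in S.
  contract : Gr n m → (Fin n → Bool) → Fin n → Gr n m
  contract g S r = record
    { vs = λ x → vs g x × (T (not (S x)) ⊎ x ≡ r)
    ; es = λ e → es g e × ¬ (T (S (proj₁ (ends g e))) × T (S (proj₂ (ends g e))))
    ; ends = λ e → f (proj₁ (ends g e)) , f (proj₂ (ends g e)) }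
    where
    f : Fin n → Fin n
    f x = if S x then r else x

  IsComponent : Gr n m → (Fin n → Bool) → Set
  IsComponent g D =
    (∃ λ x → T (D x)) ×
    (∀ x → T (D x) → vs g x) ×
    (∀ x y → T (D x) → T (D y) → Reach g x y) ×
    (∀ e x y → es g e → Joins (ends g) e x y → T (D x) → T (D y))

  -- the 2ec-w-block of M for the component D of M - w
  block : Gr n m → Fin n → (Fin n → Bool) → Gr n m
  block M w D = induced M (λ x → T (D x) ⊎ x ≡ w)

  TwoBlocks : Gr n m → Fin n → ((Fin n → Bool) → Set) → Set
  TwoBlocks M w P = ∃₂ λ D₁ D₂ →
    IsComponent (delV M w) D₁ × IsComponent (delV M w) D₂ ×
    ¬ (∀ x → D₁ x ≡ D₂ x) × P D₁ × P D₂

  -- opt(g) ≥ k : every 2-ECSS of g costs at least k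
  OptAtLeast : (Fin m → Bool) → Gr n m → ℕ → Set
  OptAtLeast z g k = ∀ (F : Fin m → Bool) → (∀ e → T (F e) → es g e) →
    TwoEC (spanSub g F) → k ≤ costOf z F

  IsCycleOn : Ends n m → (Fin n → Bool) → (Fin m → Bool) → Set
  IsCycleOn ends S F =
    (∀ e → T (F e) → T (S (proj₁ (ends e))) × T (S (proj₂ (ends e)))) ×
    (∀ x → T (S x) → deg ends F x ≡ 2) ×
    Connected (record { vs = λ x → T (S x) ; es = λ e → T (F e) ; ends = ends })

  Attach : Ends n m → (Fin n → Bool) → Fin n → Set
  Attach ends C x = T (C x) × ∃₂ λ e y → Joins ends e x y × ¬ T (C y)

  AdjTo : Ends n m → Fin n → (Fin n → Bool) → Set
  AdjTo ends x C = ∃₂ λ e y → Joins ends e x y × T (C y)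

  IsMAP : Ends n m → (Fin m → Bool) → Set
  IsMAP ends z =
    (∀ e → proj₁ (ends e) ≢ proj₂ (ends e)) ×
    TwoEC (full ends) ×
    (∀ e f → e ≢ f → T (z e) → T (z f) → ∀ x → Inc ends e x → ¬ Inc ends f x)

  Parallel : Ends n m → Fin m → Fin m → Set
  Parallel ends e f = e ≢ f × Joins ends f (proj₁ (ends e)) (proj₂ (ends e))

  del2 : Ends n m → Fin n → Fin n → Gr n m
  del2 ends u v = delVs (full ends) (λ y → y ≡ u ⊎ y ≡ v)

  pairB : Fin n → Fin n → Fin n → Bool
  pairB u v x = ⌊ x ≟ u ⌋ ∨ ⌊ x ≟ v ⌋

  ZeroS2 : Ends n m → (Fin m → Bool) → Fin m → Set
  ZeroS2 ends z e =
    T (z e) × ¬ Connected (del2 ends (proj₁ (ends e)) (proj₂ (ends e)))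

  UnitS2 : Ends n m → (Fin m → Bool) → Fin m → Set
  UnitS2 ends z e =
    z e ≡ false × ¬ Connected (del2 ends u v) ×
    TwoBlocks M u (λ D → OptAtLeast z (block M u D) 3 ×
                         ∃ λ f → es (block M u D) f × T (z f) × Inc (Gr.ends M) f u)
    where
    u = proj₁ (ends e)
    v = proj₂ (ends e)
    M = contract (full ends) (pairB u v) u

  S34 : Ends n m → (Fin m → Bool) → (Fin n → Bool) → Set
  S34 ends z C =
    (count C ≡ 3 ⊎ count C ≡ 4) ×
    TwoNC (induced (full ends) (λ x → T (C x))) ×
    (∃ λ F → IsCycleOn ends C F × costOf z F ≡ 2) ×
    ¬ Connected (delVs (full ends) (λ x → T (C x))) ×
    (∀ e → T (z e) → C (proj₁ (ends e)) ≡ C (proj₂ (ends e))) ×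
    (∃ λ r → T (C r) ×
      TwoBlocks (contract (full ends) C r) r
        (λ D → OptAtLeast z (block (contract (full ends) C r) r D) 3))

  R4 : Ends n m → (Fin m → Bool) → (Fin n → Bool) → Set
  R4 ends z C =
    count C ≡ 4 × (∃ λ x → C x ≡ false) ×
    (∃ λ F → IsCycleOn ends C F × costOf z F ≡ 2) ×
    (∃₂ λ x y → x ≢ y × T (C x) × T (C y) × (∀ e → ¬ Joins ends e x y) ×
       deg ends (λ _ → true) x ≡ 2 × deg ends (λ _ → true) y ≡ 2)

  -- condition on the unit-edge of C_i - a_i
  R8cond : Ends n m → (Fin m → Bool) → (Fin m → Bool) → Fin n → (Fin n → Bool) → Set
  R8cond ends z Fi ai Cj = ∀ e → T (Fi e) → ¬ Inc ends e ai → z e ≡ false →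
    AdjTo ends (proj₁ (ends e)) Cj × AdjTo ends (proj₂ (ends e)) Cj

  R8 : Ends n m → (Fin m → Bool) → (Fin n → Bool) → Set
  R8 ends z C =
    count C ≡ 8 × (∃ λ x → C x ≡ false) ×
    (∃₂ λ C₁ C₂ → ∃₂ λ F₁ F₂ → ∃₂ λ a₁ a₂ →
      (∀ x → T (C₁ x) → T (C x)) × (∀ x → T (C₂ x) → T (C x)) ×
      (∀ x → T (C₁ x) → ¬ T (C₂ x)) ×
      count C₁ ≡ 4 × count C₂ ≡ 4 ×
      IsCycleOn ends C₁ F₁ × costOf z F₁ ≡ 2 ×
      IsCycleOn ends C₂ F₂ × costOf z F₂ ≡ 2 ×
      T (C₁ a₁) × T (C₂ a₂) ×
      Attach ends C a₁ × Attach ends C a₂ ×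
      (∀ x → Attach ends C x → x ≡ a₁ ⊎ x ≡ a₂) ×
      R8cond ends z F₁ a₁ C₂ × R8cond ends z F₂ a₂ C₁)

  WellStructured : Ends n m → (Fin m → Bool) → Set
  WellStructured ends z =
    IsMAP ends z × 12 ≤ n ×
    (∀ x → ¬ IsCutNode (full ends) x) ×
    (∀ e f → ¬ Parallel ends e f) ×
    (∀ e → ¬ ZeroS2 ends z e) ×
    (∀ e → ¬ UnitS2 ends z e) ×
    (∀ C → ¬ S34 ends z C) ×
    (∀ C → ¬ R4 ends z C) ×
    (∀ C → ¬ R8 ends z C)

  SimpleSub : Ends n m → (Fin m → Bool) → Set
  SimpleSub ends H = ∀ e f → T (H e) → T (H f) → ¬ Parallel ends e f

  Bridgeless : Ends n m → (Fin m → Bool) → Set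
  Bridgeless ends H = ∀ e → T (H e) →
    Reach (delE (spanSub (full ends) H) e) (proj₁ (ends e)) (proj₂ (ends e))

  edgesOf : Ends n m → (Fin m → Bool) → (Fin n → Bool) → Fin m → Bool
  edgesOf ends H A e = H e ∧ A (proj₁ (ends e)) ∧ A (proj₂ (ends e))

  Small : Ends n m → (Fin m → Bool) → (Fin m → Bool) → (Fin n → Bool) → Set
  Small ends z H A = count (λ e → edgesOf ends H A e ∧ not (z e)) ≤ 2

  SwapEdge : Ends n m → (Fin m → Bool) → (Fin m → Bool) → (Fin n → Bool) → Fin m → Set
  SwapEdge ends z H A e =
    T (edgesOf ends H A e) × z e ≡ false ×
    Attach ends A (proj₁ (ends e)) × Attach ends A (proj₂ (ends e))

  SwapPair : Ends n m → (Fin m → Bool) → (Fin m → Bool) → (Fin n → Bool) →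
             Fin n → Fin n → Set
  SwapPair ends z H A u w =
    T (A u) × T (A w) ×
    ((∃ λ e → SwapEdge ends z H A e × Joins ends e u w) ⊎
     (u ≢ w × (∀ e → T (edgesOf ends H A e) → ¬ Joins ends e u w) ×
      count A ≡ 4 ×
      (∃₂ λ x y → x ≢ y × T (A x) × T (A y) ×
         x ≢ u × x ≢ w × y ≢ u × y ≢ w × (∃ λ e → Joins ends e x y))))

  IsThreeCycle : Ends n m → (Fin m → Bool) → (Fin n → Bool) → Set
  IsThreeCycle ends H A = count A ≡ 3 × IsCycleOn ends A (edgesOf ends H A)

-- Since zero-edges form a matching and every node of H has degree at least two, every
-- node of the block A lies on a unit-edge of H; as A is small it has exactly two
-- unit-edges e₁ and e₂, and their ends are all the nodes of A. If e₁ and e₂ share an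
-- end s, then A is a triangle s p q closed by a zero-edge pq; otherwise A is a 4-cycle
-- of cost 2 alternating between unit- and zero-edges. In either shape, if A had no
-- swappable edge or pair, its few attachments would make G contain a cut node, a
-- zero-cost S2 or an R4.
module Submission where

open import Defs
open import Data.Nat using (ℕ; zero; suc; _+_; _≤_; _<_; z≤n; s≤s; s≤s⁻¹)
import Data.Nat.Properties as ℕ
open import Data.Fin using (Fin; zero; suc)
open import Data.Fin.Properties using (_≟_; any?; ¬∀⟶∃¬; pigeonhole)
import Data.Fin.Properties as Fin
open import Data.Bool using (Bool; true; false; T; not; _∧_; if_then_else_)
open import Data.Bool.Properties using (T?; T-∧; T-∨; T-not-≡; T-≡)
open import Data.List using (List; []; _∷_; length; lookup)
open import Data.List.Membership.Propositional using (_∈_; _∉_)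
import Data.List.Membership.DecPropositional as DecMembership
open import Data.List.Relation.Unary.All using (All; []; _∷_)
import Data.List.Relation.Unary.All as All
open import Data.List.Relation.Unary.AllPairs using ([]; _∷_)
open import Data.List.Relation.Unary.Any using (here; there; index)
open import Data.List.Relation.Unary.Any.Properties using (lookup-index)
open import Data.List.Relation.Unary.Unique.Propositional using (Unique)
open import Data.Product using (∃; ∃₂; _×_; _,_; proj₁; proj₂)
import Data.Product as Product
open import Data.Product.Properties using (≡-dec)
open import Data.Sum using (_⊎_; inj₁; inj₂; [_,_]; [_,_]′)
import Data.Sum as Sum
open import Data.Empty using (⊥; ⊥-elim)
open import Data.Unit using (tt)
open import Function using (_∘_; id)
open import Function.Bundles using (Equivalence)
open Equivalence using (to; from)
open import Relation.Nullary using (¬_; Dec; yes; no)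
open import Relation.Nullary.Decidable
  using (⌊_⌋; toWitness; fromWitness; toWitnessFalse; fromWitnessFalse; _×-dec_; _⊎-dec_; ¬?)
open import Relation.Binary.PropositionalEquality
  using (_≡_; _≢_; refl; sym; trans; cong; cong₂; subst; module ≡-Reasoning)

T-injective : ∀ {b c} → (T b → T c) → (T c → T b) → b ≡ c
T-injective {false} {false} _ _ = refl
T-injective {false} {true}  _ c⇒b = ⊥-elim (c⇒b tt)
T-injective {true}  {false} b⇒c _ = ⊥-elim (b⇒c tt)
T-injective {true}  {true}  _ _ = refl

¬T⇒≡false : ∀ {b} → ¬ T b → b ≡ false
¬T⇒≡false {false} _  = refl
¬T⇒≡false {true}  ¬t = ⊥-elim (¬t tt)

sumF-cong : ∀ {k} {f g : Fin k → ℕ} → (∀ i → f i ≡ g i) → sumF f ≡ sumF g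
sumF-cong {zero}  f≗g = refl
sumF-cong {suc k} f≗g = cong₂ _+_ (f≗g zero) (sumF-cong (f≗g ∘ suc))

count-cong : ∀ {k} {P Q : Fin k → Bool} →
  (∀ i → T (P i) → T (Q i)) → (∀ i → T (Q i) → T (P i)) → count P ≡ count Q
count-cong P⇒Q Q⇒P =
  sumF-cong (λ i → cong (λ b → if b then 1 else 0) (T-injective (P⇒Q i) (Q⇒P i)))

count-zero : ∀ {k} {P : Fin k → Bool} → (∀ i → ¬ T (P i)) → count P ≡ 0
count-zero {zero}      _  = refl
count-zero {suc k} {P} ¬P with P zero | ¬P zero
... | false | _     = count-zero {P = P ∘ suc} (¬P ∘ suc)
... | true  | ¬true = ⊥-elim (¬true tt)

count-split : ∀ {k} (P Q : Fin k → Bool) (a : Fin k) → T (P a) →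
  (∀ i → T (Q i) → T (P i) × i ≢ a) → (∀ i → T (P i) → i ≢ a → T (Q i)) →
  count P ≡ suc (count Q)
count-split P Q zero Pa Q⇒ ⇒Q with P zero | Q zero | Q⇒ zero
... | false | _     | _  = ⊥-elim Pa
... | true  | true  | Q₀ = ⊥-elim (proj₂ (Q₀ tt) refl)
... | true  | false | _  =
  cong suc (count-cong (λ i Pi → ⇒Q (suc i) Pi λ ()) (λ i Qi → proj₁ (Q⇒ (suc i) Qi)))
count-split P Q (suc a) Pa Q⇒ ⇒Q = begin
  (if P zero then 1 else 0) + count (P ∘ suc)        ≡⟨ cong₂ _+_ same-head shifted ⟩
  (if Q zero then 1 else 0) + suc (count (Q ∘ suc))  ≡⟨ ℕ.+-suc _ _ ⟩
  suc ((if Q zero then 1 else 0) + count (Q ∘ suc))  ∎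
  where
  open ≡-Reasoning
  same-head : (if P zero then 1 else 0) ≡ (if Q zero then 1 else 0)
  same-head = cong (λ b → if b then 1 else 0)
                   (T-injective (λ P₀ → ⇒Q zero P₀ λ ()) (λ Q₀ → proj₁ (Q⇒ zero Q₀)))
  shifted : count (P ∘ suc) ≡ suc (count (Q ∘ suc))
  shifted = count-split (P ∘ suc) (Q ∘ suc) a Pa
    (λ i Qi → proj₁ (Q⇒ (suc i) Qi) , proj₂ (Q⇒ (suc i) Qi) ∘ cong suc)
    (λ i Pi i≢a → ⇒Q (suc i) Pi (i≢a ∘ Fin.suc-injective))

_∖_ : ∀ {k} → (Fin k → Bool) → Fin k → Fin k → Bool
(P ∖ a) i = P i ∧ not ⌊ i ≟ a ⌋

∖-sound : ∀ {k} (P : Fin k → Bool) a {i} → T ((P ∖ a) i) → T (P i) × i ≢ a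
∖-sound P a {i} t = Product.map₂ toWitnessFalse (to (T-∧ {P i}) t)

∖-complete : ∀ {k} (P : Fin k → Bool) a {i} → T (P i) → i ≢ a → T ((P ∖ a) i)
∖-complete P a Pi i≢a = from T-∧ (Pi , fromWitnessFalse i≢a)

count-remove : ∀ {k} (P : Fin k → Bool) a → T (P a) → count P ≡ suc (count (P ∖ a))
count-remove P a Pa = count-split P (P ∖ a) a Pa (λ _ → ∖-sound P a) (λ _ → ∖-complete P a)

-- Opaque because with-abstraction over these witnesses would otherwise unfold
-- the search over Fin k that produces them, which is very slow.
opaque
  count-witness : ∀ {k} (P : Fin k → Bool) → 1 ≤ count P → ∃ λ i → T (P i)
  count-witness P 1≤count with any? (λ i → T? (P i))
  ... | yes witness = witness
  ... | no  none    = ⊥-elim (ℕ.<⇒≢ 1≤count (sym (count-zero λ i Pi → none (i , Pi))))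

  count-two-witnesses : ∀ {k} (P : Fin k → Bool) → 2 ≤ count P →
    ∃₂ λ i j → i ≢ j × T (P i) × T (P j)
  count-two-witnesses P 2≤count with count-witness P (ℕ.≤-trans (s≤s z≤n) 2≤count)
  ... | a , Pa with count-witness (P ∖ a) (s≤s⁻¹ (subst (2 ≤_) (count-remove P a Pa) 2≤count))
  ... | b , P∖a-b = b , a , proj₂ (∖-sound P a P∖a-b) , proj₁ (∖-sound P a P∖a-b) , Pa

all-∖ : ∀ {k} (P : Fin k → Bool) {x xs} → All (x ≢_) xs → All (T ∘ P) xs → All (T ∘ (P ∖ x)) xs
all-∖ P x≢xs Pxs = All.zipWith (λ (Py , x≢y) → ∖-complete P _ Py (x≢y ∘ sym)) (Pxs , x≢xs)

length≤count : ∀ {k} {P : Fin k → Bool} {xs : List (Fin k)} →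
  Unique xs → All (T ∘ P) xs → length xs ≤ count P
length≤count []                        []          = z≤n
length≤count {P = P} (x≢xs ∷ unique) (Px ∷ Pxs) =
  subst (_ ≤_) (sym (count-remove P _ Px)) (s≤s (length≤count unique (all-∖ P x≢xs Pxs)))

count≡length : ∀ {k} {P : Fin k → Bool} {xs : List (Fin k)} →
  Unique xs → (∀ i → T (P i) → i ∈ xs) → All (T ∘ P) xs → count P ≡ length xs
count≡length [] P⊆[] [] = count-zero λ i Pi → case-[] (P⊆[] i Pi)
  where case-[] : ∀ {i} → ¬ i ∈ []
        case-[] ()
count≡length {P = P} {x ∷ xs} (x≢xs ∷ unique) P⊆ (Px ∷ Pxs) =
  trans (count-remove P x Px) (cong suc (count≡length unique P∖x⊆xs (all-∖ P x≢xs Pxs)))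
  where
  P∖x⊆xs : ∀ i → T ((P ∖ x) i) → i ∈ xs
  P∖x⊆xs i t with P⊆ i (proj₁ (∖-sound P x t))
  ... | here i≡x    = ⊥-elim (proj₂ (∖-sound P x t) i≡x)
  ... | there i∈xs = i∈xs

costOf≡count : ∀ {m} (z F : Fin m → Bool) → costOf z F ≡ count (λ e → F e ∧ not (z e))
costOf≡count z F = sumF-cong (λ e → pointwise (F e) (z e))
  where
  pointwise : ∀ f c → (if f then (if c then 0 else 1) else 0) ≡ (if f ∧ not c then 1 else 0)
  pointwise true  true  = refl
  pointwise true  false = refl
  pointwise false _     = refl

fresh-node : ∀ {n} (xs : List (Fin n)) → length xs < n → ∃ λ w → w ∉ xs
fresh-node {n} xs len<n = ¬∀⟶∃¬ n (_∈ xs) (λ w → DecMembership._∈?_ _≟_ w xs) not-all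
  where
  not-all : ¬ (∀ w → w ∈ xs)
  not-all all∈ with pigeonhole len<n (λ w → index (all∈ w))
  ... | i , j , i<j , same-index =
    Fin.<⇒≢ i<j (trans (lookup-index (all∈ i))
                  (trans (cong (lookup xs) same-index) (sym (lookup-index (all∈ j)))))

module _ {n m : ℕ} (g : Gr n m) where

  reach-closed : {S : Fin n → Set} →
    (∀ {e x y} → es g e → Joins (ends g) e x y → S x → S y) →
    ∀ {x y} → Reach g x y → S x → S y
  reach-closed closed here             Sx = Sx
  reach-closed closed (step e ge j r) Sx = reach-closed closed r (closed ge j Sx)

  reach-trans : ∀ {x y w} → Reach g x y → Reach g y w → Reach g x w
  reach-trans here             r′ = r′
  reach-trans (step e ge j r) r′ = step e ge j (reach-trans r r′)

  reach-sym : ∀ {x y} → Reach g x y → Reach g y x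
  reach-sym here             = here
  reach-sym (step e ge j r) = reach-trans (reach-sym r) (step e ge (Sum.swap j) here)

module _ {n m : ℕ} (ends : Ends n m) where

  joins-sym : ∀ {e x y} → Joins ends e x y → Joins ends e y x
  joins-sym = Sum.swap

  joins-inc : ∀ {e x y} → Joins ends e x y → Inc ends e x
  joins-inc (inj₁ refl) = inj₁ refl
  joins-inc (inj₂ refl) = inj₂ refl

  inc-joins : ∀ {e x} → Inc ends e x → ∃ λ y → Joins ends e x y
  inc-joins (inj₁ refl) = _ , inj₁ refl
  inc-joins (inj₂ refl) = _ , inj₂ refl

  joins-endpoint : ∀ {e x y u} → Joins ends e x y → Inc ends e u → u ≡ x ⊎ u ≡ y
  joins-endpoint (inj₁ refl) (inj₁ refl) = inj₁ refl
  joins-endpoint (inj₁ refl) (inj₂ refl) = inj₂ refl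
  joins-endpoint (inj₂ refl) (inj₁ refl) = inj₂ refl
  joins-endpoint (inj₂ refl) (inj₂ refl) = inj₁ refl

  joins-other : ∀ {e x y y′} → Joins ends e x y → Joins ends e x y′ → y ≡ y′
  joins-other (inj₁ refl) (inj₁ refl) = refl
  joins-other (inj₁ refl) (inj₂ eq)   = trans (cong proj₂ eq) (cong proj₁ eq)
  joins-other (inj₂ refl) (inj₁ eq)   = trans (cong proj₁ eq) (cong proj₂ eq)
  joins-other (inj₂ refl) (inj₂ refl) = refl

  joins-pair : ∀ {e u v y} → Joins ends e u v →
    y ≡ u ⊎ y ≡ v → y ≡ proj₁ (ends e) ⊎ y ≡ proj₂ (ends e)
  joins-pair (inj₁ refl) = id
  joins-pair (inj₂ refl) = Sum.swap

  pair-joins : ∀ {e u v y} → Joins ends e u v →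
    y ≡ proj₁ (ends e) ⊎ y ≡ proj₂ (ends e) → y ≡ u ⊎ y ≡ v
  pair-joins (inj₁ refl) = id
  pair-joins (inj₂ refl) = Sum.swap

  both-ends : ∀ {e x y} (P : Fin n → Set) → Joins ends e x y → P x → P y →
    P (proj₁ (ends e)) × P (proj₂ (ends e))
  both-ends P (inj₁ refl) Px Py = Px , Py
  both-ends P (inj₂ refl) Px Py = Py , Px

  parallel : ∀ {e f x y} → e ≢ f → Joins ends e x y → Joins ends f x y → Parallel ends e f
  parallel e≢f (inj₁ refl) jf = e≢f , jf
  parallel e≢f (inj₂ refl) jf = e≢f , joins-sym jf

  incB-inc : ∀ {e x} → T (incB ends e x) → Inc ends e x
  incB-inc {e} {x} t = Sum.map toWitness toWitness (to (T-∨ {⌊ proj₁ (ends e) ≟ x ⌋}) t)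

  inc-incB : ∀ {e x} → Inc ends e x → T (incB ends e x)
  inc-incB {e} {x} i = from (T-∨ {⌊ proj₁ (ends e) ≟ x ⌋}) (Sum.map fromWitness fromWitness i)

  Adjacent : Fin n → Fin n → Set
  Adjacent x y = ∃ λ e → Joins ends e x y

  joins? : ∀ e x y → Dec (Joins ends e x y)
  joins? e x y = ≡-dec _≟_ _≟_ (ends e) (x , y) ⊎-dec ≡-dec _≟_ _≟_ (ends e) (y , x)

  adjacent? : ∀ x y → Dec (Adjacent x y)
  adjacent? x y = any? λ e → joins? e x y

  attach? : ∀ C x → Dec (Attach ends C x)
  attach? C x = T? (C x) ×-dec any? λ e → any? λ y → joins? e x y ×-dec ¬? (T? (C y))

  inner-neighbour : ∀ {C x e y} → T (C x) → ¬ Attach ends C x → Joins ends e x y → T (C y)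
  inner-neighbour {C} {y = y} Cx ¬attach j with T? (C y)
  ... | yes Cy  = Cy
  ... | no  ¬Cy = ⊥-elim (¬attach (Cx , _ , _ , j , ¬Cy))

  disconnected : (D S : Fin n → Set) →
    (∀ {e x y} → S x → Joins ends e x y → S y ⊎ D y) →
    ∀ {x w} → S x → ¬ D x → ¬ S w → ¬ D w → ¬ Connected (delVs (full ends) D)
  disconnected D S closed Sx ¬Dx ¬Sw ¬Dw connected =
    ¬Sw (reach-closed (delVs (full ends) D) closed′ (connected _ _ (tt , ¬Dx) (tt , ¬Dw)) Sx)
    where
    kept : ∀ {e y} → ¬ D (proj₁ (ends e)) → ¬ D (proj₂ (ends e)) → Inc ends e y → ¬ D y
    kept ¬D₁ _   (inj₁ refl) = ¬D₁
    kept _   ¬D₂ (inj₂ refl) = ¬D₂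
    closed′ : ∀ {e x y} → es (delVs (full ends) D) e → Joins ends e x y → S x → S y
    closed′ (_ , ¬D₁ , ¬D₂) j Sx =
      [ id , (λ Dy → ⊥-elim (kept ¬D₁ ¬D₂ (joins-inc (joins-sym j)) Dy)) ] (closed Sx j)

module SmallBlock
  {n m : ℕ} (ends : Ends n m) (z : Fin m → Bool)
  (loopless : ∀ e → proj₁ (ends e) ≢ proj₂ (ends e))
  (zero-matching : ∀ e f → e ≢ f → T (z e) → T (z f) → ∀ x → Inc ends e x → ¬ Inc ends f x)
  (12≤n : 12 ≤ n)
  (no-cut-node : ∀ x → ¬ IsCutNode (full ends) x)
  (no-parallel : ∀ e f → ¬ Parallel ends e f)
  (no-zero-S2 : ∀ e → ¬ ZeroS2 ends z e)
  (no-R4 : ∀ C → ¬ R4 ends z C)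
  (H : Fin m → Bool) (zero⊆H : ∀ e → T (z e) → T (H e))
  (deg≥2 : ∀ x → 2 ≤ deg ends H x)
  (A : Fin n → Bool)
  (A-closed : ∀ e x y → T (H e) → Joins ends e x y → T (A x) → T (A y))
  (small : Small ends z H A)
  where

  Conclusion : Set
  Conclusion = (∃₂ λ u w → SwapPair ends z H A u w) ×
               (IsThreeCycle ends H A → ∃ λ e → SwapEdge ends z H A e)

  UnitEdge : Fin m → Set
  UnitEdge e = T (H e) × z e ≡ false

  OnlyUnitEdges : Fin m → Fin m → Set
  OnlyUnitEdges e₁ e₂ = ∀ {e x} → UnitEdge e → Inc ends e x → T (A x) → e ≡ e₁ ⊎ e ≡ e₂

  5≤n : 5 ≤ n
  5≤n = ℕ.≤-trans (ℕ.m≤m+n 5 7) 12≤n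

  distinct-ends : ∀ {e x y} → Joins ends e x y → x ≢ y
  distinct-ends {e} (inj₁ refl) = loopless e
  distinct-ends {e} (inj₂ refl) = loopless e ∘ sym

  parallel-equal : ∀ {e f x y} → Joins ends e x y → Joins ends f x y → e ≡ f
  parallel-equal {e} {f} je jf with e ≟ f
  ... | yes e≡f = e≡f
  ... | no  e≢f = ⊥-elim (no-parallel e f (parallel ends e≢f je jf))

  zero-edges-equal : ∀ {e f x} → T (z e) → T (z f) → Inc ends e x → Inc ends f x → e ≡ f
  zero-edges-equal {e} {f} {x} ze zf e∋x f∋x with e ≟ f
  ... | yes e≡f = e≡f
  ... | no  e≢f = ⊥-elim (zero-matching e f e≢f ze zf x e∋x f∋x)

  in-block : ∀ {e x y} → T (H e) → Joins ends e x y → T (A x) → T (edgesOf ends H A e)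
  in-block He j Ax = from T-∧ (He , from T-∧ (both-ends ends (T ∘ A) j Ax (A-closed _ _ _ He j Ax)))

  blockUnit : Fin m → Bool
  blockUnit e = edgesOf ends H A e ∧ not (z e)

  unit-in-block : ∀ {e x y} → UnitEdge e → Joins ends e x y → T (A x) → T (blockUnit e)
  unit-in-block (He , ze) j Ax = from T-∧ (in-block He j Ax , from T-not-≡ ze)

  at-most-two-unit-edges : ∀ {e e₁ e₂} → e ≢ e₁ → e ≢ e₂ → e₁ ≢ e₂ →
    T (blockUnit e) → T (blockUnit e₁) → T (blockUnit e₂) → ⊥
  at-most-two-unit-edges e≢e₁ e≢e₂ e₁≢e₂ u u₁ u₂ =
    ℕ.≤⇒≯ small (length≤count ((e≢e₁ ∷ e≢e₂ ∷ []) ∷ (e₁≢e₂ ∷ []) ∷ [] ∷ []) (u ∷ u₁ ∷ u₂ ∷ []))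

  two-H-edges : ∀ x → ∃₂ λ f g → f ≢ g × (T (H f) × Inc ends f x) × (T (H g) × Inc ends g x)
  two-H-edges x with count-two-witnesses (λ e → H e ∧ incB ends e x) (deg≥2 x)
  ... | f , g , f≢g , Pf , Pg = f , g , f≢g , H-inc Pf , H-inc Pg
    where
    H-inc : ∀ {e} → T (H e ∧ incB ends e x) → T (H e) × Inc ends e x
    H-inc t = Product.map₂ (incB-inc ends) (to T-∧ t)

  another-H-edge : ∀ e x → ∃ λ f → f ≢ e × T (H f) × Inc ends f x
  another-H-edge e x with two-H-edges x
  ... | f , g , f≢g , f-at-x , g-at-x with f ≟ e
  ... | yes refl = g , f≢g ∘ sym , g-at-x
  ... | no  f≢e  = f , f≢e , f-at-x

  unit-edge-at : ∀ x → ∃ λ e → UnitEdge e × Inc ends e x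
  unit-edge-at x with two-H-edges x
  ... | f , g , f≢g , (Hf , f∋x) , (Hg , g∋x) with z f in zf | z g in zg
  ... | false | _     = f , (Hf , zf) , f∋x
  ... | true  | false = g , (Hg , zg) , g∋x
  ... | true  | true  = ⊥-elim (f≢g (zero-edges-equal (from T-≡ zf) (from T-≡ zg) f∋x g∋x))

  zero-edge-beside : ∀ {e x x′} → Joins ends e x x′ → (∀ {f} → UnitEdge f → Inc ends f x → f ≡ e) →
    ∃₂ λ g y → T (z g) × Joins ends g x y × y ≢ x′
  zero-edge-beside {e} {x} j only-e with another-H-edge e x
  ... | f , f≢e , Hf , f∋x with z f in zf
  ... | false = ⊥-elim (f≢e (only-e (Hf , zf) f∋x))
  ... | true with inc-joins ends f∋x
  ... | y , jf = f , y , from T-≡ zf , jf , λ y≡x′ → f≢e (parallel-equal (subst (Joins ends f x) y≡x′ jf) j)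

  -- If the second H-edge at a is a zero-edge ay, the unit-edge at y ∈ A cannot be
  -- e₁ = ab, since y ≠ a and a second edge between a and b would be parallel to e₁.
  second-unit-edge : ∀ {a b e₁} → T (A a) → Joins ends e₁ a b →
    ∃ λ e₂ → e₂ ≢ e₁ × UnitEdge e₂ × ∃₂ λ c d → Joins ends e₂ c d × T (A c)
  second-unit-edge {a} {b} {e₁} Aa ab with another-H-edge e₁ a
  ... | f , f≢e₁ , Hf , f∋a with z f in zf
  ... | false = f , f≢e₁ , (Hf , zf) , a , _ , proj₂ (inc-joins ends f∋a) , Aa
  ... | true with inc-joins ends f∋a
  ... | y , ay with unit-edge-at y
  ... | h , unit-h , h∋y with h ≟ e₁
  ... | no h≢e₁ = h , h≢e₁ , unit-h , y , _ , proj₂ (inc-joins ends h∋y) , A-closed _ _ _ Hf ay Aa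
  ... | yes refl with joins-endpoint ends ab h∋y
  ...   | inj₁ refl = ⊥-elim (distinct-ends ay refl)
  ...   | inj₂ refl = ⊥-elim (f≢e₁ (parallel-equal ay ab))

  only-unit-edges : ∀ {e₁ e₂ a b c d} → e₁ ≢ e₂ → UnitEdge e₁ → UnitEdge e₂ →
    Joins ends e₁ a b → Joins ends e₂ c d → T (A a) → T (A c) → OnlyUnitEdges e₁ e₂
  only-unit-edges {e₁} {e₂} e₁≢e₂ u₁ u₂ ab cd Aa Ac {e} u e∋x Ax with e ≟ e₁ | e ≟ e₂
  ... | yes e≡e₁ | _        = inj₁ e≡e₁
  ... | no  _    | yes e≡e₂ = inj₂ e≡e₂
  ... | no e≢e₁  | no e≢e₂  = ⊥-elim (at-most-two-unit-edges e≢e₁ e≢e₂ e₁≢e₂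
      (unit-in-block u (proj₂ (inc-joins ends e∋x)) Ax) (unit-in-block u₁ ab Aa) (unit-in-block u₂ cd Ac))

  covered : ∀ {e₁ e₂ x} → OnlyUnitEdges e₁ e₂ → T (A x) → Inc ends e₁ x ⊎ Inc ends e₂ x
  covered only Ax with unit-edge-at _
  ... | e , u , e∋x with only u e∋x Ax
  ... | inj₁ refl = inj₁ e∋x
  ... | inj₂ refl = inj₂ e∋x

  no-zero-separator : ∀ {g u v} → T (z g) → Joins ends g u v → (S : Fin n → Set) →
    (∀ {e x y} → S x → Joins ends e x y → S y ⊎ (y ≡ u ⊎ y ≡ v)) →
    ∀ {x w} → S x → ¬ (x ≡ u ⊎ x ≡ v) → ¬ S w → ¬ (w ≡ u ⊎ w ≡ v) → ⊥
  no-zero-separator {g} zg uv S closed Sx x∉uv ¬Sw w∉uv =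
    no-zero-S2 g (zg , disconnected ends _ S (λ Sx j → Sum.map₂ (joins-pair ends uv) (closed Sx j))
                         Sx (x∉uv ∘ pair-joins ends uv) ¬Sw (w∉uv ∘ pair-joins ends uv))

  no-cut-separator : ∀ s (S : Fin n → Set) → (∀ {e x y} → S x → Joins ends e x y → S y ⊎ y ≡ s) →
    ∀ {x w} → S x → x ≢ s → ¬ S w → w ≢ s → ⊥
  no-cut-separator s S closed Sx x≢s ¬Sw w≢s =
    no-cut-node s (tt , disconnected ends (_≡ s) S closed Sx x≢s ¬Sw w≢s)

  swap-edge : ∀ {e x y} → UnitEdge e → Joins ends e x y → T (A x) →
    Attach ends A x → Attach ends A y → SwapEdge ends z H A e
  swap-edge (He , ze) j Ax attach-x attach-y =
    in-block He j Ax , ze , both-ends ends (Attach ends A) j attach-x attach-y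

  swap-edge-conclusion : ∀ {e} → SwapEdge ends z H A e → Conclusion
  swap-edge-conclusion {e} swap@(e∈A , _) =
    (proj₁ (ends e) , proj₂ (ends e) , proj₁ ends∈A , proj₂ ends∈A , inj₁ (e , swap , inj₁ refl)) ,
    λ _ → e , swap
    where
    ends∈A : T (A (proj₁ (ends e))) × T (A (proj₂ (ends e)))
    ends∈A = to T-∧ (proj₂ (to (T-∧ {H e}) e∈A))

  module Triangle {e₁ e₂ s p q} (only : OnlyUnitEdges e₁ e₂)
    (unit₁ : UnitEdge e₁) (unit₂ : UnitEdge e₂) (sp : Joins ends e₁ s p) (sq : Joins ends e₂ s q)
    (e₁≢e₂ : e₁ ≢ e₂) (A-s : T (A s)) where

    A-p : T (A p)
    A-p = A-closed _ _ _ (proj₁ unit₁) sp A-s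

    corners : ∀ {x} → T (A x) → x ≡ s ⊎ x ≡ p ⊎ x ≡ q
    corners Ax = [ Sum.map₂ inj₁ ∘ joins-endpoint ends sp , Sum.map₂ inj₂ ∘ joins-endpoint ends sq ]
                   (covered only Ax)

    p≢q : p ≢ q
    p≢q refl = e₁≢e₂ (parallel-equal sp sq)

    only-e₁-at-p : ∀ {f} → UnitEdge f → Inc ends f p → f ≡ e₁
    only-e₁-at-p u f∋p with only u f∋p A-p
    ... | inj₁ f≡e₁ = f≡e₁
    ... | inj₂ refl = ⊥-elim ([ distinct-ends sp ∘ sym , p≢q ] (joins-endpoint ends sq f∋p))

    zero-pq : ∃ λ g → T (z g) × Joins ends g p q
    zero-pq with zero-edge-beside (joins-sym ends sp) only-e₁-at-p
    ... | g , y , zg , py , y≢s =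
      g , zg , subst (Joins ends g p) (y≡q (corners (A-closed g p y (zero⊆H g zg) py A-p))) py
      where
      y≡q : y ≡ s ⊎ y ≡ p ⊎ y ≡ q → y ≡ q
      y≡q = [ ⊥-elim ∘ y≢s , [ ⊥-elim ∘ distinct-ends py ∘ sym , id ]′ ]′

    fresh-w : ∃ λ w → w ∉ s ∷ p ∷ q ∷ []
    fresh-w = fresh-node _ (ℕ.≤-trans (ℕ.n≤1+n 4) 5≤n)

    w : Fin n
    w = proj₁ fresh-w

    w∉ : w ∉ s ∷ p ∷ q ∷ []
    w∉ = proj₂ fresh-w

    no-inner-s : ¬ Attach ends A s → ⊥
    no-inner-s s-in = no-zero-separator (proj₁ (proj₂ zero-pq)) (proj₂ (proj₂ zero-pq)) (_≡ s) closed
      refl [ distinct-ends sp , distinct-ends sq ]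
      (w∉ ∘ here) [ w∉ ∘ there ∘ here , w∉ ∘ there ∘ there ∘ here ]
      where
      closed : ∀ {e x y} → x ≡ s → Joins ends e x y → y ≡ s ⊎ (y ≡ p ⊎ y ≡ q)
      closed refl j = corners (inner-neighbour ends A-s s-in j)

    no-inner-p-q : ¬ Attach ends A p → ¬ Attach ends A q → ⊥
    no-inner-p-q p-in q-in = no-cut-separator s (λ x → x ≡ p ⊎ x ≡ q) closed
      (inj₁ refl) (distinct-ends sp ∘ sym)
      [ w∉ ∘ there ∘ here , w∉ ∘ there ∘ there ∘ here ] (w∉ ∘ here)
      where
      reorder : ∀ {y} → y ≡ s ⊎ y ≡ p ⊎ y ≡ q → (y ≡ p ⊎ y ≡ q) ⊎ y ≡ s
      reorder = [ inj₂ , inj₁ ]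
      closed : ∀ {e x y} → x ≡ p ⊎ x ≡ q → Joins ends e x y → (y ≡ p ⊎ y ≡ q) ⊎ y ≡ s
      closed (inj₁ refl) j = reorder (corners (inner-neighbour ends A-p p-in j))
      closed (inj₂ refl) j = reorder (corners (inner-neighbour ends (A-closed _ _ _ (proj₁ unit₂) sq A-s) q-in j))

    -- If s is no attachment, the zero-edge pq separates s from the rest of G;
    -- if neither p nor q is one, s is a cut node.
    swap-edge-in-triangle : ∃ λ e → SwapEdge ends z H A e
    swap-edge-in-triangle with attach? ends A s | attach? ends A p | attach? ends A q
    ... | yes s-out | yes p-out | _         = e₁ , swap-edge unit₁ sp A-s s-out p-out
    ... | yes s-out | _         | yes q-out = e₂ , swap-edge unit₂ sq A-s s-out q-out
    ... | no  s-in  | _         | _         = ⊥-elim (no-inner-s s-in)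
    ... | yes _     | no p-in   | no q-in   = ⊥-elim (no-inner-p-q p-in q-in)

  record Square : Set where
    field
      a b c d     : Fin n
      e₁ g₁ e₂ g₂ : Fin m
      ab : Joins ends e₁ a b
      bc : Joins ends g₁ b c
      cd : Joins ends e₂ c d
      da : Joins ends g₂ d a
      unit₁ : UnitEdge e₁
      unit₂ : UnitEdge e₂
      zero₁ : T (z g₁)
      zero₂ : T (z g₂)
      a≢c : a ≢ c
      b≢d : b ≢ d
      only : OnlyUnitEdges e₁ e₂
      A-a : T (A a)

  module SquareBasics (S : Square) where
    open Square S public

    A-b : T (A b)
    A-b = A-closed _ _ _ (proj₁ unit₁) ab A-a

    A-c : T (A c)
    A-c = A-closed _ _ _ (zero⊆H g₁ zero₁) bc A-b

    A-d : T (A d)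
    A-d = A-closed _ _ _ (proj₁ unit₂) cd A-c

    a≢b : a ≢ b
    a≢b = distinct-ends ab

    b≢c : b ≢ c
    b≢c = distinct-ends bc

    c≢d : c ≢ d
    c≢d = distinct-ends cd

    d≢a : d ≢ a
    d≢a = distinct-ends da

    Corners : List (Fin n)
    Corners = a ∷ b ∷ c ∷ d ∷ []

    corners : ∀ {x} → T (A x) → x ∈ Corners
    corners Ax =
      [ [ here , there ∘ here ]′ ∘ joins-endpoint ends ab
      , [ there ∘ there ∘ here , there ∘ there ∘ there ∘ here ]′ ∘ joins-endpoint ends cd
      ]′ (covered only Ax)

    corners-unique : Unique Corners
    corners-unique = (a≢b ∷ a≢c ∷ d≢a ∘ sym ∷ []) ∷ (b≢c ∷ b≢d ∷ []) ∷ (c≢d ∷ []) ∷ [] ∷ []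

    e₁≢g₂ : e₁ ≢ g₂
    e₁≢g₂ refl = subst T (proj₂ unit₁) zero₂

    H-edges-at-a : ∀ {f} → T (H f) → Inc ends f a → f ≡ e₁ ⊎ f ≡ g₂
    H-edges-at-a {f} Hf f∋a with z f in zf
    ... | true  = inj₂ (zero-edges-equal (from T-≡ zf) zero₂ f∋a (joins-inc ends (joins-sym ends da)))
    ... | false with only (Hf , zf) f∋a A-a
    ...   | inj₁ f≡e₁ = inj₁ f≡e₁
    ...   | inj₂ refl = ⊥-elim ([ a≢c , d≢a ∘ sym ] (joins-endpoint ends cd f∋a))

    block-degree-at-a : deg ends (edgesOf ends H A) a ≡ 2
    block-degree-at-a = count≡length ((e₁≢g₂ ∷ []) ∷ [] ∷ []) only-e₁-g₂
      (from T-∧ (in-block (proj₁ unit₁) ab A-a , inc-incB ends (joins-inc ends ab)) ∷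
       from T-∧ (in-block (zero⊆H g₂ zero₂) ad A-a , inc-incB ends (joins-inc ends ad)) ∷ [])
      where
      ad : Joins ends g₂ a d
      ad = joins-sym ends da
      only-e₁-g₂ : ∀ f → T (edgesOf ends H A f ∧ incB ends f a) → f ∈ e₁ ∷ g₂ ∷ []
      only-e₁-g₂ f t with to (T-∧ {edgesOf ends H A f}) t
      ... | f∈A , f∋a = [ here , there ∘ here ]′
                          (H-edges-at-a (proj₁ (to (T-∧ {H f}) f∈A)) (incB-inc ends f∋a))

    degree-at-a : ¬ Attach ends A a → (∀ e → ¬ Joins ends e a c) → deg ends (λ _ → true) a ≡ 2
    degree-at-a a-in ¬ac = count≡length ((e₁≢g₂ ∷ []) ∷ [] ∷ []) only-e₁-g₂
      (inc-incB ends (joins-inc ends ab) ∷ inc-incB ends (joins-inc ends (joins-sym ends da)) ∷ [])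
      where
      only-e₁-g₂ : ∀ f → T (incB ends f a) → f ∈ e₁ ∷ g₂ ∷ []
      only-e₁-g₂ f t with inc-joins ends (incB-inc ends t)
      ... | y , ay with corners (inner-neighbour ends A-a a-in ay)
      ... | here refl                         = ⊥-elim (distinct-ends ay refl)
      ... | there (here refl)                 = here (parallel-equal ay ab)
      ... | there (there (here refl))         = ⊥-elim (¬ac f ay)
      ... | there (there (there (here refl))) = there (here (parallel-equal ay (joins-sym ends da)))

  -- The reflection a ↔ b, c ↔ d and the rotation by two corners preserve the
  -- configuration, so what SquareBasics proves at the corner a holds at every corner.
  flip : Square → Square
  flip S = record
    { a = b ; b = a ; c = d ; d = c ; e₁ = e₁ ; g₁ = g₂ ; e₂ = e₂ ; g₂ = g₁
    ; ab = joins-sym ends ab ; bc = joins-sym ends da ; cd = joins-sym ends cd ; da = joins-sym ends bc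
    ; unit₁ = unit₁ ; unit₂ = unit₂ ; zero₁ = zero₂ ; zero₂ = zero₁
    ; a≢c = b≢d ; b≢d = a≢c ; only = only ; A-a = A-b }
    where open SquareBasics S

  rotate : Square → Square
  rotate S = record
    { a = c ; b = d ; c = a ; d = b ; e₁ = e₂ ; g₁ = g₂ ; e₂ = e₁ ; g₂ = g₁
    ; ab = cd ; bc = da ; cd = ab ; da = bc
    ; unit₁ = unit₂ ; unit₂ = unit₁ ; zero₁ = zero₂ ; zero₂ = zero₁
    ; a≢c = a≢c ∘ sym ; b≢d = b≢d ∘ sym ; only = λ u i Ax → Sum.swap (only u i Ax) ; A-a = A-c }
    where open SquareBasics S

  module SquareFacts (S : Square) where
    open SquareBasics S public
    private
      module B = SquareBasics (flip S)
      module C = SquareBasics (rotate S)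
      module D = SquareBasics (flip (rotate S))

    size : count A ≡ 4
    size = count≡length corners-unique (λ _ → corners) (A-a ∷ A-b ∷ A-c ∷ A-d ∷ [])

    not-three-cycle : ¬ IsThreeCycle ends H A
    not-three-cycle (three , _) = 4≢3 (trans (sym size) three)
      where
      4≢3 : 4 ≢ 3
      4≢3 ()

    e₁≢e₂ : e₁ ≢ e₂
    e₁≢e₂ refl = [ a≢c ∘ sym , b≢c ∘ sym ] (joins-endpoint ends ab (joins-inc ends cd))

    e₁∈A : T (edgesOf ends H A e₁)
    e₁∈A = in-block (proj₁ unit₁) ab A-a

    g₁∈A : T (edgesOf ends H A g₁)
    g₁∈A = in-block (zero⊆H g₁ zero₁) bc A-b

    g₂∈A : T (edgesOf ends H A g₂)
    g₂∈A = in-block (zero⊆H g₂ zero₂) da A-d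

    BlockGraph : Gr n m
    BlockGraph = record { vs = λ x → T (A x) ; es = λ e → T (edgesOf ends H A e) ; ends = ends }

    reach-from-a : ∀ {x} → x ∈ Corners → Reach BlockGraph a x
    reach-from-a (here refl)                         = here
    reach-from-a (there (here refl))                 = step e₁ e₁∈A ab here
    reach-from-a (there (there (here refl)))         = step e₁ e₁∈A ab (step g₁ g₁∈A bc here)
    reach-from-a (there (there (there (here refl)))) = step g₂ g₂∈A (joins-sym ends da) here

    block-cycle : IsCycleOn ends A (edgesOf ends H A)
    block-cycle = (λ e t → to T-∧ (proj₂ (to (T-∧ {H e}) t))) , degree , connected
      where
      degree : ∀ x → T (A x) → deg ends (edgesOf ends H A) x ≡ 2
      degree x Ax with corners Ax
      ... | here refl                         = block-degree-at-a
      ... | there (here refl)                 = B.block-degree-at-a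
      ... | there (there (here refl))         = C.block-degree-at-a
      ... | there (there (there (here refl))) = D.block-degree-at-a
      connected : Connected BlockGraph
      connected x y Ax Ay =
        reach-trans BlockGraph (reach-sym BlockGraph (reach-from-a (corners Ax))) (reach-from-a (corners Ay))

    block-cost : costOf z (edgesOf ends H A) ≡ 2
    block-cost = trans (costOf≡count z (edgesOf ends H A))
      (count≡length ((e₁≢e₂ ∷ []) ∷ [] ∷ []) only-e₁-e₂
        (unit-in-block unit₁ ab A-a ∷ unit-in-block unit₂ cd A-c ∷ []))
      where
      only-e₁-e₂ : ∀ f → T (blockUnit f) → f ∈ e₁ ∷ e₂ ∷ []
      only-e₁-e₂ f t with to (T-∧ {edgesOf ends H A f}) t
      ... | f∈A , unit-f with to (T-∧ {H f}) f∈A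
      ... | Hf , ends∈A = [ here , there ∘ here ]′
                            (only (Hf , to T-not-≡ unit-f) (inj₁ refl) (proj₁ (to T-∧ ends∈A)))

    swap-edge₁ : Attach ends A a → Attach ends A b → SwapEdge ends z H A e₁
    swap-edge₁ = swap-edge unit₁ ab A-a

    outside : ∃ λ w → A w ≡ false
    outside with fresh-node Corners 5≤n
    ... | w , w∉ = w , ¬T⇒≡false (w∉ ∘ corners)

    swap-pair : Adjacent ends b d → ∃₂ λ u w → SwapPair ends z H A u w
    swap-pair bd = a , c , A-a , A-c , inj₂ (a≢c , no-block-edge-ac , size ,
      b , d , b≢d , A-b , A-d , a≢b ∘ sym , b≢c , d≢a , c≢d ∘ sym , bd)
      where
      no-block-edge-ac : ∀ e → T (edgesOf ends H A e) → ¬ Joins ends e a c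
      no-block-edge-ac e t ac with H-edges-at-a (proj₁ (to (T-∧ {H e}) t)) (joins-inc ends ac)
      ... | inj₁ refl = b≢c (joins-other ends ab ac)
      ... | inj₂ refl = c≢d (sym (joins-other ends (joins-sym ends da) ac))

    -- Two opposite corners of degree 2 in G would make A an R4.
    no-inner-opposite-corners : ¬ Attach ends A a → ¬ Attach ends A c → ¬ Adjacent ends a c → ⊥
    no-inner-opposite-corners a-in c-in ¬ac = no-R4 A
      (size , outside , (_ , block-cycle , block-cost) , a , c , a≢c , A-a , A-c , ¬ac′ ,
       degree-at-a a-in ¬ac′ , C.degree-at-a c-in (λ e → ¬ac′ e ∘ joins-sym ends))
      where
      ¬ac′ : ∀ e → ¬ Joins ends e a c
      ¬ac′ e ac = ¬ac (e , ac)

    -- The zero-edge bc would separate {a, d} from the rest of G.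
    no-inner-adjacent-corners : ¬ Attach ends A a → ¬ Attach ends A d → ⊥
    no-inner-adjacent-corners a-in d-in with fresh-node Corners 5≤n
    ... | w , w∉ = no-zero-separator zero₁ bc (λ x → x ≡ a ⊎ x ≡ d) closed (inj₁ refl) [ a≢b , a≢c ]
      [ w∉ ∘ here , w∉ ∘ there ∘ there ∘ there ∘ here ]
      [ w∉ ∘ there ∘ here , w∉ ∘ there ∘ there ∘ here ]
      where
      sides : ∀ {y} → y ∈ Corners → (y ≡ a ⊎ y ≡ d) ⊎ (y ≡ b ⊎ y ≡ c)
      sides (here y≡a)                         = inj₁ (inj₁ y≡a)
      sides (there (here y≡b))                 = inj₂ (inj₁ y≡b)
      sides (there (there (here y≡c)))         = inj₂ (inj₂ y≡c)
      sides (there (there (there (here y≡d)))) = inj₁ (inj₂ y≡d)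
      closed : ∀ {e x y} → x ≡ a ⊎ x ≡ d → Joins ends e x y → (y ≡ a ⊎ y ≡ d) ⊎ (y ≡ b ⊎ y ≡ c)
      closed (inj₁ refl) j = sides (corners (inner-neighbour ends A-a a-in j))
      closed (inj₂ refl) j = sides (corners (inner-neighbour ends A-d d-in j))

  module SquareCases (S : Square) where
    open SquareFacts S
    private
      module F = SquareFacts (flip S)
      module R = SquareFacts (rotate S)

    conclusion : Conclusion
    conclusion with adjacent? ends b d | adjacent? ends a c
    ... | yes bd | _      = swap-pair bd , ⊥-elim ∘ not-three-cycle
    ... | no _   | yes ac = F.swap-pair ac , ⊥-elim ∘ not-three-cycle
    ... | no ¬bd | no ¬ac with attach? ends A a | attach? ends A b | attach? ends A c | attach? ends A d
    ... | yes a-out | yes b-out | _        | _         = swap-edge-conclusion (swap-edge₁ a-out b-out)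
    ... | _         | _         | yes c-out | yes d-out = swap-edge-conclusion (R.swap-edge₁ c-out d-out)
    ... | no a-in   | _         | no c-in  | _         = ⊥-elim (no-inner-opposite-corners a-in c-in ¬ac)
    ... | _         | no b-in   | _        | no d-in   = ⊥-elim (F.no-inner-opposite-corners b-in d-in ¬bd)
    ... | no a-in   | _         | _        | no d-in   = ⊥-elim (no-inner-adjacent-corners a-in d-in)
    ... | _         | no b-in   | no c-in  | _         = ⊥-elim (F.no-inner-adjacent-corners b-in c-in)

  module Disjoint {e₁ e₂ : Fin m} {a b c d : Fin n} (only : OnlyUnitEdges e₁ e₂)
    (unit₁ : UnitEdge e₁) (unit₂ : UnitEdge e₂) (ab : Joins ends e₁ a b) (cd : Joins ends e₂ c d)
    (A-a : T (A a)) (a≢c : a ≢ c) (a≢d : a ≢ d) (b≢c : b ≢ c) (b≢d : b ≢ d) where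

    A-b : T (A b)
    A-b = A-closed _ _ _ (proj₁ unit₁) ab A-a

    only-e₁-at : ∀ {x f} → T (A x) → x ≢ c → x ≢ d → UnitEdge f → Inc ends f x → f ≡ e₁
    only-e₁-at Ax x≢c x≢d u f∋x =
      [ id , (λ { refl → ⊥-elim ([ x≢c , x≢d ]′ (joins-endpoint ends cd f∋x)) }) ]′ (only u f∋x Ax)

    zero-edge-across : ∀ {x x′} → Joins ends e₁ x x′ → T (A x) → x ≢ c → x ≢ d →
      ∃ λ g → T (z g) × (Joins ends g x c ⊎ Joins ends g x d)
    zero-edge-across xx′ Ax x≢c x≢d with zero-edge-beside xx′ (only-e₁-at Ax x≢c x≢d)
    ... | g , y , zg , xy , y≢x′ = g , zg ,
      [ (λ e₁∋y → ⊥-elim ([ distinct-ends xy ∘ sym , y≢x′ ]′ (joins-endpoint ends xx′ e₁∋y)))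
      , (λ e₂∋y → Sum.map (λ y≡c → subst (Joins ends g _) y≡c xy) (λ y≡d → subst (Joins ends g _) y≡d xy)
                          (joins-endpoint ends cd e₂∋y))
      ]′ (covered only (A-closed _ _ _ (zero⊆H g zg) xy Ax))

    no-common-zero-neighbour : ∀ {g g′ y} → T (z g) → T (z g′) →
      Joins ends g b y → Joins ends g′ a y → ⊥
    no-common-zero-neighbour zg zg′ by ay
      with zero-edges-equal zg zg′ (joins-inc ends (joins-sym ends by)) (joins-inc ends (joins-sym ends ay))
    ... | refl = distinct-ends ab (joins-other ends (joins-sym ends ay) (joins-sym ends by))

    -- The zero-edges at b and at a end in {c, d}, at different nodes since
    -- zero-edges form a matching; this closes the 4-cycle a b c d or a b d c.
    square : Square
    square = close (zero-edge-across (joins-sym ends ab) A-b b≢c b≢d) (zero-edge-across ab A-a a≢c a≢d)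
      where
      close : (∃ λ g → T (z g) × (Joins ends g b c ⊎ Joins ends g b d)) →
              (∃ λ g → T (z g) × (Joins ends g a c ⊎ Joins ends g a d)) → Square
      close (g , zg , inj₁ bc) (g′ , zg′ , inj₂ ad) = record
        { a = a ; b = b ; c = c ; d = d ; e₁ = e₁ ; g₁ = g ; e₂ = e₂ ; g₂ = g′
        ; ab = ab ; bc = bc ; cd = cd ; da = joins-sym ends ad
        ; unit₁ = unit₁ ; unit₂ = unit₂ ; zero₁ = zg ; zero₂ = zg′
        ; a≢c = a≢c ; b≢d = b≢d ; only = only ; A-a = A-a }
      close (g , zg , inj₂ bd) (g′ , zg′ , inj₁ ac) = record
        { a = a ; b = b ; c = d ; d = c ; e₁ = e₁ ; g₁ = g ; e₂ = e₂ ; g₂ = g′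
        ; ab = ab ; bc = bd ; cd = joins-sym ends cd ; da = joins-sym ends ac
        ; unit₁ = unit₁ ; unit₂ = unit₂ ; zero₁ = zg ; zero₂ = zg′
        ; a≢c = a≢d ; b≢d = b≢c ; only = only ; A-a = A-a }
      close (g , zg , inj₁ bc) (g′ , zg′ , inj₁ ac) = ⊥-elim (no-common-zero-neighbour zg zg′ bc ac)
      close (g , zg , inj₂ bd) (g′ , zg′ , inj₂ ad) = ⊥-elim (no-common-zero-neighbour zg zg′ bd ad)

  triangle-conclusion : ∀ {e₁ e₂ s p q} → OnlyUnitEdges e₁ e₂ → UnitEdge e₁ → UnitEdge e₂ →
    Joins ends e₁ s p → Joins ends e₂ s q → e₁ ≢ e₂ → T (A s) → Conclusion
  triangle-conclusion only u₁ u₂ sp sq e₁≢e₂ A-s =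
    swap-edge-conclusion (proj₂ (Triangle.swap-edge-in-triangle only u₁ u₂ sp sq e₁≢e₂ A-s))

  two-unit-edges : ∀ {e₁ e₂ a b c d} → OnlyUnitEdges e₁ e₂ → e₁ ≢ e₂ → UnitEdge e₁ → UnitEdge e₂ →
    Joins ends e₁ a b → Joins ends e₂ c d → T (A a) → Conclusion
  two-unit-edges {a = a} {b} {c} {d} only e₁≢e₂ u₁ u₂ ab cd A-a with c ≟ a | c ≟ b | d ≟ a | d ≟ b
  ... | yes refl | _ | _ | _ = triangle-conclusion only u₁ u₂ ab cd e₁≢e₂ A-a
  ... | no _ | yes refl | _ | _ =
    triangle-conclusion only u₁ u₂ (joins-sym ends ab) cd e₁≢e₂ (A-closed _ _ _ (proj₁ u₁) ab A-a)
  ... | no _ | no _ | yes refl | _ =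
    triangle-conclusion only u₁ u₂ ab (joins-sym ends cd) e₁≢e₂ A-a
  ... | no _ | no _ | no _ | yes refl =
    triangle-conclusion only u₁ u₂ (joins-sym ends ab) (joins-sym ends cd) e₁≢e₂
      (A-closed _ _ _ (proj₁ u₁) ab A-a)
  ... | no c≢a | no c≢b | no d≢a | no d≢b = SquareCases.conclusion
    (Disjoint.square only u₁ u₂ ab cd A-a (c≢a ∘ sym) (d≢a ∘ sym) (c≢b ∘ sym) (d≢b ∘ sym))

  swappable : ∀ {a} → T (A a) → Conclusion
  swappable {a} A-a with unit-edge-at a
  ... | e₁ , u₁ , e₁∋a with inc-joins ends e₁∋a
  ... | b , ab with second-unit-edge A-a ab
  ... | e₂ , e₂≢e₁ , u₂ , c , d , cd , A-c =
    two-unit-edges (only-unit-edges (e₂≢e₁ ∘ sym) u₁ u₂ ab cd A-a A-c) (e₂≢e₁ ∘ sym) u₁ u₂ ab cd A-a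

lemma33 : ∀ {n m : ℕ} (ends : Ends n m) (z : Fin m → Bool) →
    WellStructured ends z →
    (H : Fin m → Bool) →
    (∀ e → T (z e) → T (H e)) →
    SimpleSub ends H →
    Bridgeless ends H →
    (∀ x → 2 ≤ deg ends H x) →
    (A : Fin n → Bool) →
    IsComponent (spanSub (full ends) H) A →
    Small ends z H A →
    (∃₂ λ u w → SwapPair ends z H A u w) ×
    (IsThreeCycle ends H A → ∃ λ e → SwapEdge ends z H A e)
lemma33 ends z ((loopless , _ , zero-matching) , 12≤n , no-cut-node , no-parallel , no-zero-S2 , _ , _ , no-R4 , _)
        H zero⊆H _ _ deg≥2 A (A-nonempty , _ , _ , A-closed) small =
  SmallBlock.swappable ends z loopless zero-matching 12≤n no-cut-node no-parallel no-zero-S2 no-R4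
    H zero⊆H deg≥2 A A-closed small (proj₂ A-nonempty)
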